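{- Let $A(\vec{x},\vec{y})$ and $B(\vec{y},\vec{z})$ be quantifier-free first-order formulas sharing exactly the variables $\vec{y}$, and consider the procedure $\textsc{interpolate}(A,B)$ described in the context, where every individual oracle call terminates. If the check-modulo-a-model oracle used for $A$ has the finite convergence property, then $\textsc{interpolate}(A,B)$ always terminates.
   Context: A model is a type-consistent assignment of values to variables; $M\vDash F$ means $F$ is true under $M$; $M\supseteq M_0$ means $M$ extends $M_0$. A solver $S$ keeps a set of asserted formulas. $S.\mathrm{check}()$ returns $\langle\mathsf{sat},M\rangle$ with $M$ a model of the asserted formulas if one exists, and $\langle\mathsf{unsat},\emptyset\rangle$ otherwise. $S.\mathrm{check}(M_0)$, for a partial assignment $M_0$, returns $\langle\mathsf{sat},M,\top\rangle$ with $M\supseteq M_0$ a model of the asserted formulas $F$ if one exists, and otherwise $\langle\mathsf{unsat},\emptyset,I\rangle$ where $I$ is a model interpolant between $F$ and $M_0$: $F\Rightarrow I$ is valid and $M_0\vDash\neg I$. Procedure $\textsc{interpolate}(A,B)$: assert $A$ to $S_A$, $B$ to $S_B$; $I:=\top$. Loop: $\langle r_B,M_B\rangle:=S_B.\mathrm{check}()$; if $r_B=\mathsf{unsat}$ return $\langle\mathsf{unsat},I\rangle$. Else $\langle r_A,M_A,I_A\rangle:=S_A.\mathrm{check}(M_B)$; if $r_A=\mathsf{sat}$ return $\langle\mathsf{sat},M_A\cup M_B\rangle$. Else $I:=I\wedge I_A$, $S_B.\mathrm{assert}(I_A)$, repeat. Model interpolation sequence: given a formula $A(\vec{x},\vec{y})$,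 a sequence of models $(M_k)$ of $\vec{y}$ and a sequence of formulas $(I_k)$ over $\vec{y}$, $(I_k)$ is a model interpolation sequence for $A$ and $(M_k)$ if for all $k$: (1) $M_k$ is consistent with $\bigwedge_{i<k}I_i$; (2) $M_k$ is inconsistent with $A$ (no extension of $M_k$ satisfies $A$); (3) $I_k$ is a model interpolant between $A$ and $M_k$. The check-modulo-a-model oracle has the finite convergence property if the model interpolants it produces never form an infinite model interpolation sequence. -}

module Defs where

open import Data.Nat using (ℕ; zero; suc; _<_)
open import Data.List using (List; []; _∷_; _++_; [_])
open import Data.List.Relation.Unary.All using (All)
open import Data.Product using (Σ; _×_; _,_; ∃)
open import Relation.Nullary using (¬_)
open import Data.Unit using (⊤)
open import Data.Empty using (⊥)
open import Relation.Binary.PropositionalEquality using (_≡_)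

-- MX, MY, MZ : (type-consistent) assignments to the variable vectors x, y, z.
--   FY         : formulas over the shared variables y (the interpolant language),
--                with truth relation  M ⊨ F.
--   A mx my    : A(x,y) is true under the model (mx,my).
--   B my mz    : B(y,z) is true under the model (my,mz).
record Setting : Set₁ where
  field
    MX MY MZ FY : Set
    _⊨_ : MY → FY → Set
    A   : MX → MY → Set
    B   : MY → MZ → Set

module _ (S : Setting) where
  open Setting S

  -- Result of S_A.check(M0), M0 a (partial) assignment of the shared variables y.
  -- sat: an extension M ⊇ M0 (i.e. a value for x) with M ⊨ A.
  -- unsat: a model interpolant I: A ⇒ I valid and M0 ⊨ ¬ I.
  data ResultA (m₀ : MY) : Set where
    satA   : (mx : MX) → A mx m₀ → ResultA m₀
    unsatA : (I : FY) → (∀ mx my → A mx my → my ⊨ I) → ¬ (m₀ ⊨ I) → ResultA m₀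

  -- check-modulo-a-model oracle for A (each call terminates: it is a total function)
  OracleA : Set
  OracleA = (m₀ : MY) → ResultA m₀

  -- Result of S_B.check() when S_B holds B together with the asserted formulas Is.
  data ResultB (Is : List FY) : Set where
    satB   : (my : MY) (mz : MZ) → B my mz → All (my ⊨_) Is → ResultB Is
    unsatB : (¬ Σ MY λ my → Σ MZ λ mz → B my mz × All (my ⊨_) Is) → ResultB Is

  OracleB : Set
  OracleB = (Is : List FY) → ResultB Is

  Produces : OracleA → MY → FY → Set
  Produces checkA m I = Σ (∀ mx my → A mx my → my ⊨ I) λ p → Σ (¬ (m ⊨ I)) λ q →
                          checkA m ≡ unsatA I p q

  InconsistentWithA : MY → Set
  InconsistentWithA m = ¬ Σ MX λ mx → A mx m

  ModelInterpolant : MY → FY → Set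
  ModelInterpolant m I = (∀ mx my → A mx my → my ⊨ I) × ¬ (m ⊨ I)

  IsModelInterpolationSeq : (ℕ → MY) → (ℕ → FY) → Set
  IsModelInterpolationSeq Ms Is = ∀ k →
      (∀ i → i < k → Ms k ⊨ Is i)
    × InconsistentWithA (Ms k)
    × ModelInterpolant (Ms k) (Is k)

  FiniteConvergence : OracleA → Set
  FiniteConvergence checkA =
    ¬ Σ (ℕ → MY) λ Ms → Σ (ℕ → FY) λ Is →
        IsModelInterpolationSeq Ms Is × (∀ k → Produces checkA (Ms k) (Is k))

  -- State of the interpolate loop: still running with the interpolants asserted
  -- so far (I = their conjunction), or halted with a result.
  data State : Set where
    running   : List FY → State
    doneUnsat : List FY → State          -- ⟨unsat, ⋀ Is⟩
    doneSat   : MX → MY → MZ → State      -- ⟨sat, M_A ∪ M_B⟩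

  step : OracleA → OracleB → State → State
  step checkA checkB (running Is) with checkB Is
  ... | unsatB _ = doneUnsat Is
  ... | satB my mz _ _ with checkA my
  ...   | satA mx _ = doneSat mx my mz
  ...   | unsatA I _ _ = running (Is ++ [ I ])
  step checkA checkB s = s

  run : OracleA → OracleB → ℕ → State
  run checkA checkB zero = running []
  run checkA checkB (suc n) = step checkA checkB (run checkA checkB n)

  IsRunning : State → Set
  IsRunning (running _) = ⊤
  IsRunning _ = ⊥

  Terminates : OracleA → OracleB → Set
  Terminates checkA checkB = ¬ (∀ n → IsRunning (run checkA checkB n))

{-# OPTIONS --safe #-}
-- If the loop never halted, iteration k would see B's model M_k (a model of all
-- interpolants asserted so far) refuted by A's oracle with an interpolant I_k.
-- The asserted list after k rounds is I_0, …, I_{k-1}, so (M_k) and (I_k) form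
-- an infinite model interpolation sequence made of oracle outputs, which finite
-- convergence forbids.
module Submission where

open import Defs
open import Data.Nat using (ℕ; zero; suc; _<_; s≤s)
open import Data.Nat.Properties using (m≤n⇒m<n∨m≡n)
open import Data.List using (List; []; _++_; [_])
open import Data.List.Relation.Unary.All as All using (All)
open import Data.List.Relation.Unary.Any using (here)
open import Data.List.Membership.Propositional using (_∈_)
open import Data.List.Membership.Propositional.Properties using (∈-++⁺ˡ; ∈-++⁺ʳ)
open import Data.Product using (Σ; _,_; proj₁; proj₂)
open import Data.Sum using (inj₁; inj₂)
open import Data.Empty using (⊥-elim)
open import Function using (_∘_)
open import Relation.Binary.PropositionalEquality using (_≡_; refl; trans; cong; subst)

∈-appended : {X : Set} (Ls : ℕ → List X) (f : ℕ → X) →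
             (∀ k → Ls (suc k) ≡ Ls k ++ [ f k ]) →
             ∀ {i k} → i < k → f i ∈ Ls k
∈-appended Ls f Ls-suc {i} {suc k} (s≤s i≤k) rewrite Ls-suc k with m≤n⇒m<n∨m≡n i≤k
... | inj₁ i<k  = ∈-++⁺ˡ (∈-appended Ls f Ls-suc i<k)
... | inj₂ refl = ∈-++⁺ʳ (Ls i) (here refl)

module _ (S : Setting) where
  open Setting S

  interpolant⇒inconsistentWithA : ∀ {m I} → ModelInterpolant S m I → InconsistentWithA S m
  interpolant⇒inconsistentWithA (A⇒I , m⊭I) (mx , a) = m⊭I (A⇒I mx _ a)

  produces⇒modelInterpolant : ∀ checkA {m I} → Produces S checkA m I → ModelInterpolant S m I
  produces⇒modelInterpolant _ (A⇒I , m⊭I , _) = A⇒I , m⊭I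

  module _ (checkA : OracleA S) (checkB : OracleB S) where

    record InterpolantStep (Is : List FY) : Set where
      field
        model       : MY
        interpolant : FY
        model⊨Is    : All (model ⊨_) Is
        produces    : Produces S checkA model interpolant
        step≡       : step S checkA checkB (running Is) ≡ running (Is ++ [ interpolant ])

    step-unsatA : ∀ Is {my mz b my⊨Is I A⇒I my⊭I} →
                  checkB Is ≡ satB my mz b my⊨Is → checkA my ≡ unsatA I A⇒I my⊭I →
                  step S checkA checkB (running Is) ≡ running (Is ++ [ I ])
    step-unsatA Is eqB eqA rewrite eqB | eqA = refl

    running⇒interpolantStep : ∀ Is → IsRunning S (step S checkA checkB (running Is)) →
                              InterpolantStep Is
    running⇒interpolantStep Is r with checkB Is in eqB
    ... | unsatB _ = ⊥-elim r
    ... | satB my mz b my⊨Is with checkA my in eqA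
    ...   | satA _ _ = ⊥-elim r
    ...   | unsatA I A⇒I my⊭I = record
      { model = my ; interpolant = I ; model⊨Is = my⊨Is
      ; produces = A⇒I , my⊭I , eqA ; step≡ = step-unsatA Is eqB eqA }

    module NonTerminating (forever : ∀ n → IsRunning S (run S checkA checkB n)) where

      -- Built together with the steps, so the asserted list grows by one interpolant
      -- per round definitionally.
      trace : ∀ n → Σ (List FY) λ Is → run S checkA checkB n ≡ running Is
      stepAt : ∀ n → InterpolantStep (proj₁ (trace n))

      trace zero = [] , refl
      trace (suc n) = proj₁ (trace n) ++ [ InterpolantStep.interpolant (stepAt n) ]
                    , trans (cong (step S checkA checkB) (proj₂ (trace n)))
                            (InterpolantStep.step≡ (stepAt n))

      stepAt n = running⇒interpolantStep (proj₁ (trace n))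
        (subst (IsRunning S ∘ step S checkA checkB) (proj₂ (trace n)) (forever (suc n)))

      models : ℕ → MY
      models = InterpolantStep.model ∘ stepAt

      interpolants : ℕ → FY
      interpolants = InterpolantStep.interpolant ∘ stepAt

      produced : ∀ k → Produces S checkA (models k) (interpolants k)
      produced = InterpolantStep.produces ∘ stepAt

      isModelInterpolationSeq : IsModelInterpolationSeq S models interpolants
      isModelInterpolationSeq k =
          (λ i i<k → All.lookup (InterpolantStep.model⊨Is (stepAt k))
                       (∈-appended (proj₁ ∘ trace) interpolants (λ _ → refl) i<k))
        , interpolant⇒inconsistentWithA interpolant
        , interpolant
        where interpolant = produces⇒modelInterpolant checkA (produced k)

lemma2 : (S : Setting) (checkA : OracleA S) (checkB : OracleB S) →
    FiniteConvergence S checkA → Terminates S checkA checkB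
lemma2 S checkA checkB finite forever =
  finite (models , interpolants , isModelInterpolationSeq , produced)
  where open NonTerminating S checkA checkB forever
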